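{- Let $f:\{0,1\}^n\to\{0,1\}$ be a decision list represented by rules $(x_{i_1},b_1,v_1),\dots,(x_{i_k},b_k,v_k),v_{\mathrm{default}}$ in which no variable index appears twice and at least one $v_j$ equals $1$, and let $p$ (the pivot) be the smallest index in $[k]$ with $v_p=1$. Then $\Pr_{z\sim f^{ -1}(1)}[z_{i_p}=b_p]\ge 1/2$, and $\Pr_{z\sim f^{ -1}(1)}[z_{i_j}=1]\in[1/4,3/4]$ for every $j$ with $p<j\le k$.
   Context: A decision list given by rules $(x_{i_1},b_1,v_1),\dots,(x_{i_k},b_k,v_k),v_{\mathrm{default}}$ (with $i_j\in[n]$, $b_j,v_j,v_{\mathrm{default}}\in\{0,1\}$) computes $f(x)=v_j$ for the smallest $j$ with $x_{i_j}=b_j$, and $f(x)=v_{\mathrm{default}}$ if no such $j$ exists. $z\sim f^{ -1}(1)$ denotes a uniformly random element of $f^{ -1}(1)$. -}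

module Defs where

open import Data.Nat using (ℕ; zero; suc)
open import Data.Bool using (Bool; true; false; _≟_)
open import Data.Fin using (Fin)
open import Data.Vec using (Vec; []; _∷_; lookup)
open import Data.List using (List; []; _∷_; _++_; map; filter; length)
open import Data.Product using (_×_; _,_; proj₁; proj₂)
open import Relation.Nullary using (yes; no)

Rule : ℕ → Set
Rule n = Fin n × Bool × Bool

ruleVar : ∀ {n} → Rule n → Fin n
ruleVar (i , b , v) = i

ruleBit : ∀ {n} → Rule n → Bool
ruleBit (i , b , v) = b

ruleVal : ∀ {n} → Rule n → Bool
ruleVal (i , b , v) = v

-- Evaluation of the decision list (rules, default) on input x ∈ {0,1}^n
-- (false = 0, true = 1): first rule whose test x_i = b fires outputs v.
evalDL : ∀ {n} → List (Rule n) → Bool → Vec Bool n → Bool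
evalDL [] vdef x = vdef
evalDL ((i , b , v) ∷ rs) vdef x with lookup x i ≟ b
... | yes _ = v
... | no _ = evalDL rs vdef x

allInputs : (n : ℕ) → List (Vec Bool n)
allInputs zero = [] ∷ []
allInputs (suc n) = map (false ∷_) (allInputs n) ++ map (true ∷_) (allInputs n)

preimage1 : ∀ {n} → (Vec Bool n → Bool) → List (Vec Bool n)
preimage1 {n} f = filter (λ z → f z ≟ true) (allInputs n)

countPre : ∀ {n} → (Vec Bool n → Bool) → Fin n → Bool → ℕ
countPre f i b = length (filter (λ z → lookup z i ≟ b) (preimage1 f))

{-# OPTIONS --safe #-}
-- Let S be the set of inputs that reach the pivot rule, i.e. pass none of the earlier
-- tests. All earlier rules output 0, so f⁻¹(1) ⊆ S, and on the half-cube z_{i_p} = b_p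
-- the function f coincides with S. The variables are distinct, so S does not depend on
-- z_{i_p}: flipping that bit maps f⁻¹(1) ∩ {z_{i_p} ≠ b_p} into S ∩ {z_{i_p} ≠ b_p}, which
-- has the same size as S ∩ {z_{i_p} = b_p} = f⁻¹(1) ∩ {z_{i_p} = b_p}. For a later rule j, S ∩ {z_{i_p} = b_p} is moreover symmetric in z_{i_j}, so it
-- has 2a elements, a of them with z_{i_j} = 1. With g = |f⁻¹(1) ∩ {z_{i_p} ≠ b_p}| and c
-- the number of those with z_{i_j} = 1 we get |f⁻¹(1)| = 2a + g and
-- |f⁻¹(1) ∩ {z_{i_j} = 1}| = a + c, where c ≤ g ≤ 2a; this pins the ratio to [1/4, 3/4].

module Submission where

open import Algebra.Bundles using (CommutativeMonoid)
import Algebra.Properties.CommutativeSemigroup as CommSemigroupProperties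
open import Data.Bool using (Bool; true; false; not; _∧_; _≟_; if_then_else_)
open import Data.Bool.Properties using (∧-zeroʳ; ∧-commutativeMonoid)
open import Data.Empty using (⊥-elim)
open import Data.Fin using (Fin; zero; suc; _<_)
open import Data.Fin.Properties using (<⇒≢; <-trans)
open import Data.List using (List; []; _∷_; _++_; map; filter; length; lookup)
open import Data.List.Properties using (filter-++; length-++; length-map)
open import Data.List.Membership.Propositional.Properties using (∈-lookup)
open import Data.List.Relation.Unary.All as All using ()
open import Data.List.Relation.Unary.All.Properties using (map⁻)
open import Data.List.Relation.Unary.AllPairs using (_∷_)
open import Data.List.Relation.Unary.Any using (Any)
open import Data.List.Relation.Unary.Unique.Propositional using (Unique)
open import Data.Nat using (ℕ; zero; suc; _+_; _*_; _≤_; z≤n; s≤s)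
open import Data.Nat.Properties
  using (≤-refl; ≤-trans; m≤m+n; +-comm; +-identityʳ; +-monoʳ-≤; +-mono-≤; *-monoʳ-≤; +-commutativeSemigroup; module ≤-Reasoning)
open import Data.Nat.Tactic.RingSolver using (solve-∀)
open import Data.Product using (_×_; _,_)
open import Data.Vec using (Vec; []; _∷_; _[_]%=_)
import Data.Vec as Vec
open import Data.Vec.Properties using (lookup∘updateAt; lookup∘updateAt′)
open import Function using (_∘_)
open import Level using (Level)
open import Relation.Binary.PropositionalEquality
  using (_≡_; _≢_; refl; sym; trans; cong; cong₂; subst; subst₂; ≢-sym; module ≡-Reasoning)
open import Relation.Nullary using (Dec; does; yes; no)
open import Relation.Nullary.Decidable using (⌊_⌋)
open import Relation.Unary using (Pred; Decidable)

open import Defs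

open CommSemigroupProperties (CommutativeMonoid.commutativeSemigroup ∧-commutativeMonoid)
  using (xy∙z≈xz∙y)
open CommSemigroupProperties +-commutativeSemigroup using (interchange)

private variable
  ℓ : Level
  n : ℕ
  A B : Set

_∩_ : (A → Bool) → (A → Bool) → A → Bool
(P ∩ Q) x = P x ∧ Q x

∁ : (A → Bool) → A → Bool
∁ P x = not (P x)

infixl 7 _∩_

_⊆_ : (A → Bool) → (A → Bool) → Set
P ⊆ Q = ∀ x → P x ≡ true → Q x ≡ true

infix 4 _⊆_

∩-⊆ˡ : (P Q : A → Bool) → P ∩ Q ⊆ P
∩-⊆ˡ P Q x with P x
... | true = λ _ → refl
... | false = λ ()

∩-monoˡ-⊆ : {P R : A → Bool} (Q : A → Bool) → P ⊆ R → P ∩ Q ⊆ R ∩ Q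
∩-monoˡ-⊆ {P = P} {R} Q P⊆R x with P x | P⊆R x
... | true | Rx rewrite Rx refl = λ Qx → Qx
... | false | _ = λ ()

bitIs : Fin n → Bool → Vec Bool n → Bool
bitIs k b x = ⌊ Vec.lookup x k ≟ b ⌋

≟-not : ∀ u b → ⌊ not u ≟ b ⌋ ≡ not ⌊ u ≟ b ⌋
≟-not false false = refl
≟-not false true = refl
≟-not true false = refl
≟-not true true = refl

flipBit : Fin n → Vec Bool n → Vec Bool n
flipBit k x = x [ k ]%= not

FlipInvariant : Fin n → (Vec Bool n → Bool) → Set
FlipInvariant k P = ∀ x → P (flipBit k x) ≡ P x

∩-flipInvariant : ∀ {k : Fin n} {P Q} → FlipInvariant k P → FlipInvariant k Q → FlipInvariant k (P ∩ Q)
∩-flipInvariant P-inv Q-inv x = cong₂ _∧_ (P-inv x) (Q-inv x)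

bitIs-flipInvariant : ∀ {k m : Fin n} b → k ≢ m → FlipInvariant m (bitIs k b)
bitIs-flipInvariant {k = k} {m} b k≢m x = cong (λ u → ⌊ u ≟ b ⌋) (lookup∘updateAt′ k m k≢m x)

count : (Vec Bool n → Bool) → ℕ
count {zero} P = if P [] then 1 else 0
count {suc n} P = count (P ∘ (false ∷_)) + count (P ∘ (true ∷_))

count-cong : {P Q : Vec Bool n → Bool} → (∀ x → P x ≡ Q x) → count P ≡ count Q
count-cong {zero} P≗Q = cong (if_then 1 else 0) (P≗Q [])
count-cong {suc n} P≗Q = cong₂ _+_ (count-cong (P≗Q ∘ (false ∷_))) (count-cong (P≗Q ∘ (true ∷_)))

count-mono : {P Q : Vec Bool n → Bool} → P ⊆ Q → count P ≤ count Q
count-mono {zero} {P} {Q} P⊆Q with P [] | P⊆Q []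
... | false | _ = z≤n
... | true | Q[] rewrite Q[] refl = ≤-refl
count-mono {suc n} P⊆Q =
  +-mono-≤ (count-mono (P⊆Q ∘ (false ∷_))) (count-mono (P⊆Q ∘ (true ∷_)))

count-split : (P Q : Vec Bool n → Bool) → count P ≡ count (P ∩ Q) + count (P ∩ ∁ Q)
count-split {zero} P Q with P [] | Q []
... | false | _ = refl
... | true | true = refl
... | true | false = refl
count-split {suc n} P Q = begin
  count (P ∘ (false ∷_)) + count (P ∘ (true ∷_))
    ≡⟨ cong₂ _+_ (count-split (P ∘ (false ∷_)) (Q ∘ (false ∷_)))
                 (count-split (P ∘ (true ∷_)) (Q ∘ (true ∷_))) ⟩
  (count ((P ∩ Q) ∘ (false ∷_)) + count ((P ∩ ∁ Q) ∘ (false ∷_)))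
    + (count ((P ∩ Q) ∘ (true ∷_)) + count ((P ∩ ∁ Q) ∘ (true ∷_)))
    ≡⟨ interchange (count ((P ∩ Q) ∘ (false ∷_))) (count ((P ∩ ∁ Q) ∘ (false ∷_)))
                    (count ((P ∩ Q) ∘ (true ∷_))) (count ((P ∩ ∁ Q) ∘ (true ∷_))) ⟩
  count (P ∩ Q) + count (P ∩ ∁ Q) ∎
  where open ≡-Reasoning

count-∩-swap : (P Q R : Vec Bool n → Bool) → count (P ∩ Q ∩ R) ≡ count (P ∩ R ∩ Q)
count-∩-swap P Q R = count-cong (λ x → xy∙z≈xz∙y (P x) (Q x) (R x))

count-flip : ∀ (k : Fin n) P → count (P ∘ flipBit k) ≡ count P
count-flip {suc n} zero P = +-comm (count (P ∘ (true ∷_))) (count (P ∘ (false ∷_)))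
count-flip {suc n} (suc k) P =
  cong₂ _+_ (count-flip k (P ∘ (false ∷_))) (count-flip k (P ∘ (true ∷_)))

count-balanced : ∀ {k : Fin n} {R} b → FlipInvariant k R →
                 count (R ∩ bitIs k b) ≡ count (R ∩ ∁ (bitIs k b))
count-balanced {k = k} {R} b R-inv = begin
  count (R ∩ bitIs k b)                  ≡⟨ count-flip k (R ∩ bitIs k b) ⟨
  count ((R ∩ bitIs k b) ∘ flipBit k)    ≡⟨ count-cong flipped ⟩
  count (R ∩ ∁ (bitIs k b))              ∎
  where
  open ≡-Reasoning
  flipped : ∀ x → (R ∩ bitIs k b) (flipBit k x) ≡ (R ∩ ∁ (bitIs k b)) x
  flipped x = cong₂ _∧_ (R-inv x)
    (trans (cong (λ u → ⌊ u ≟ b ⌋) (lookup∘updateAt k x)) (≟-not (Vec.lookup x k) b))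

quarter-bounds : ∀ a c g → c ≤ g → g ≤ a + a →
                 (a + a) + g ≤ 4 * (a + c) × 4 * (a + c) ≤ 3 * ((a + a) + g)
quarter-bounds a c g c≤g g≤2a = lower , upper
  where
  open ≤-Reasoning
  2a+2a≡4a : ∀ a → (a + a) + (a + a) ≡ 4 * a
  2a+2a≡4a = solve-∀
  4[a+c]≡4a+[c+3c] : ∀ a c → 4 * (a + c) ≡ 4 * a + (c + 3 * c)
  4[a+c]≡4a+[c+3c] = solve-∀
  4a+[2a+3g]≡3[2a+g] : ∀ a g → 4 * a + ((a + a) + 3 * g) ≡ 3 * ((a + a) + g)
  4a+[2a+3g]≡3[2a+g] = solve-∀

  lower : (a + a) + g ≤ 4 * (a + c)
  lower = begin
    (a + a) + g        ≤⟨ +-monoʳ-≤ (a + a) g≤2a ⟩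
    (a + a) + (a + a)  ≡⟨ 2a+2a≡4a a ⟩
    4 * a              ≤⟨ *-monoʳ-≤ 4 (m≤m+n a c) ⟩
    4 * (a + c)        ∎
  upper : 4 * (a + c) ≤ 3 * ((a + a) + g)
  upper = begin
    4 * (a + c)               ≡⟨ 4[a+c]≡4a+[c+3c] a c ⟩
    4 * a + (c + 3 * c)       ≤⟨ +-monoʳ-≤ (4 * a) (+-mono-≤ (≤-trans c≤g g≤2a) (*-monoʳ-≤ 3 c≤g)) ⟩
    4 * a + ((a + a) + 3 * g) ≡⟨ 4a+[2a+3g]≡3[2a+g] a g ⟩
    3 * ((a + a) + g)         ∎

module PivotCounting {f S : Vec Bool n → Bool} {k : Fin n} {b : Bool}
    (f⊆S : f ⊆ S)
    (f≡S-on-pivot : ∀ x → (f ∩ bitIs k b) x ≡ (S ∩ bitIs k b) x)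
    (S-flipInvariant : FlipInvariant k S)
  where

  private
    pivot : Vec Bool n → Bool
    pivot = bitIs k b

  count-off-pivot≤count-on-pivot : count (f ∩ ∁ pivot) ≤ count (f ∩ pivot)
  count-off-pivot≤count-on-pivot = begin
    count (f ∩ ∁ pivot)  ≤⟨ count-mono (∩-monoˡ-⊆ (∁ pivot) f⊆S) ⟩
    count (S ∩ ∁ pivot)  ≡⟨ count-balanced b S-flipInvariant ⟨
    count (S ∩ pivot)    ≡⟨ count-cong f≡S-on-pivot ⟨
    count (f ∩ pivot)    ∎
    where open ≤-Reasoning

  pivot-bound : count f ≤ 2 * count (f ∩ pivot)
  pivot-bound = begin
    count f                                  ≡⟨ count-split f pivot ⟩
    count (f ∩ pivot) + count (f ∩ ∁ pivot)  ≤⟨ +-monoʳ-≤ (count (f ∩ pivot)) count-off-pivot≤count-on-pivot ⟩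
    count (f ∩ pivot) + count (f ∩ pivot)    ≡⟨ cong (count (f ∩ pivot) +_) (+-identityʳ (count (f ∩ pivot))) ⟨
    2 * count (f ∩ pivot)                    ∎
    where open ≤-Reasoning

  later-bounds : ∀ m → k ≢ m → FlipInvariant m S →
                 count f ≤ 4 * count (f ∩ bitIs m true) × 4 * count (f ∩ bitIs m true) ≤ 3 * count f
  later-bounds m k≢m S-flipInvariant-m =
    subst₂ (λ T X → T ≤ 4 * X × 4 * X ≤ 3 * T) (sym total≡2a+g) (sym f∩later≡a+c)
      (quarter-bounds a c g c≤g g≤2a)
    where
    open ≡-Reasoning
    later : Vec Bool n → Bool
    later = bitIs m true

    a c g : ℕ
    a = count (S ∩ pivot ∩ later)
    c = count (f ∩ ∁ pivot ∩ later)
    g = count (f ∩ ∁ pivot)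

    f∩pivot≡a+a : count (f ∩ pivot) ≡ a + a
    f∩pivot≡a+a = begin
      count (f ∩ pivot)                ≡⟨ count-cong f≡S-on-pivot ⟩
      count (S ∩ pivot)                ≡⟨ count-split (S ∩ pivot) later ⟩
      a + count (S ∩ pivot ∩ ∁ later)  ≡⟨ cong (a +_) (count-balanced true S∩pivot-flipInvariant) ⟨
      a + a                            ∎
      where
      S∩pivot-flipInvariant : FlipInvariant m (S ∩ pivot)
      S∩pivot-flipInvariant = ∩-flipInvariant S-flipInvariant-m (bitIs-flipInvariant b k≢m)

    total≡2a+g : count f ≡ (a + a) + g
    total≡2a+g = trans (count-split f pivot) (cong (_+ g) f∩pivot≡a+a)

    f∩later≡a+c : count (f ∩ later) ≡ a + c
    f∩later≡a+c = begin
      count (f ∩ later)                                        ≡⟨ count-split (f ∩ later) pivot ⟩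
      count (f ∩ later ∩ pivot) + count (f ∩ later ∩ ∁ pivot)
        ≡⟨ cong₂ _+_ (count-∩-swap f later pivot) (count-∩-swap f later (∁ pivot)) ⟩
      count (f ∩ pivot ∩ later) + c
        ≡⟨ cong (_+ c) (count-cong (λ x → cong (_∧ later x) (f≡S-on-pivot x))) ⟩
      a + c                                                    ∎

    c≤g : c ≤ g
    c≤g = count-mono (∩-⊆ˡ (f ∩ ∁ pivot) later)

    g≤2a : g ≤ a + a
    g≤2a = subst (g ≤_) f∩pivot≡a+a count-off-pivot≤count-on-pivot

fires : Rule n → Vec Bool n → Bool
fires r = bitIs (ruleVar r) (ruleBit r)

reaches : (rules : List (Rule n)) → Fin (length rules) → Vec Bool n → Bool
reaches (r ∷ rules) zero x = true
reaches (r ∷ rules) (suc p) x = (∁ (fires r) ∩ reaches rules p) x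

module _ (vdef : Bool) where

  evalDL⊆reaches : ∀ (rules : List (Rule n)) p →
                   (∀ j → j < p → ruleVal (lookup rules j) ≡ false) →
                   evalDL rules vdef ⊆ reaches rules p
  evalDL⊆reaches (r ∷ rules) zero _ x _ = refl
  evalDL⊆reaches ((i , b , v) ∷ rules) (suc p) earlier-false x with earlier-false zero (s≤s z≤n)
  ... | refl with Vec.lookup x i ≟ b
  ... | yes _ = λ ()
  ... | no _ = evalDL⊆reaches rules p (λ j j<p → earlier-false (suc j) (s≤s j<p)) x

  evalDL≡reaches-on-fired : ∀ (rules : List (Rule n)) p →
    ruleVal (lookup rules p) ≡ true →
    (∀ j → j < p → ruleVal (lookup rules j) ≡ false) →
    ∀ x → (evalDL rules vdef ∩ fires (lookup rules p)) x ≡ (reaches rules p ∩ fires (lookup rules p)) x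
  evalDL≡reaches-on-fired ((i , b , v) ∷ rules) zero refl _ x with Vec.lookup x i ≟ b
  ... | yes _ = refl
  ... | no _ = ∧-zeroʳ _
  evalDL≡reaches-on-fired ((i , b , v) ∷ rules) (suc p) vₚ≡true earlier-false x
    with earlier-false zero (s≤s z≤n)
  ... | refl with Vec.lookup x i ≟ b
  ... | yes _ = refl
  ... | no _ = evalDL≡reaches-on-fired rules p vₚ≡true (λ j j<p → earlier-false (suc j) (s≤s j<p)) x

reaches-flipInvariant : ∀ (rules : List (Rule n)) p {m} →
                        (∀ j → j < p → ruleVar (lookup rules j) ≢ m) →
                        FlipInvariant m (reaches rules p)
reaches-flipInvariant (r ∷ rules) zero _ x = refl
reaches-flipInvariant (r ∷ rules) (suc p) earlier≢m =
  ∩-flipInvariant (cong not ∘ bitIs-flipInvariant (ruleBit r) (earlier≢m zero (s≤s z≤n)))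
                  (reaches-flipInvariant rules p (λ j j<p → earlier≢m (suc j) (s≤s j<p)))

unique-map⇒lookup-≢ : (g : A → B) (xs : List A) → Unique (map g xs) →
                      ∀ {i j} → i ≢ j → g (lookup xs i) ≢ g (lookup xs j)
unique-map⇒lookup-≢ g (x ∷ xs) _ {zero} {zero} i≢j = ⊥-elim (i≢j refl)
unique-map⇒lookup-≢ g (x ∷ xs) (x∉ ∷ _) {zero} {suc j} _ = All.lookup (map⁻ x∉) (∈-lookup j)
unique-map⇒lookup-≢ g (x ∷ xs) (x∉ ∷ _) {suc i} {zero} _ = ≢-sym (All.lookup (map⁻ x∉) (∈-lookup i))
unique-map⇒lookup-≢ g (x ∷ xs) (_ ∷ unique) {suc i} {suc j} i≢j =
  unique-map⇒lookup-≢ g xs unique (i≢j ∘ cong suc)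

filter-map : {P : Pred B ℓ} (P? : Decidable P) (g : A → B) (xs : List A) →
             filter P? (map g xs) ≡ map g (filter (P? ∘ g) xs)
filter-map P? g [] = refl
filter-map P? g (x ∷ xs) with does (P? (g x))
... | true = cong (g x ∷_) (filter-map P? g xs)
... | false = filter-map P? g xs

filter-filter : (P : A → Bool) {Q : Pred A ℓ} (Q? : Decidable Q) (xs : List A) →
                filter Q? (filter (λ z → P z ≟ true) xs) ≡ filter (λ z → (P z ∧ ⌊ Q? z ⌋) ≟ true) xs
filter-filter P Q? [] = refl
filter-filter P Q? (x ∷ xs) with P x
... | false = filter-filter P Q? xs
... | true with Q? x
...   | yes _ = cong (x ∷_) (filter-filter P Q? xs)
...   | no _ = filter-filter P Q? xs

length-preimage1 : (f : Vec Bool n → Bool) → length (preimage1 f) ≡ count f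
length-preimage1 {zero} f with f []
... | true = refl
... | false = refl
length-preimage1 {suc n} f = begin
  length (filter f? (map (false ∷_) inputs ++ map (true ∷_) inputs))
    ≡⟨ cong length (filter-++ f? (map (false ∷_) inputs) (map (true ∷_) inputs)) ⟩
  length (filter f? (map (false ∷_) inputs) ++ filter f? (map (true ∷_) inputs))
    ≡⟨ length-++ (filter f? (map (false ∷_) inputs)) ⟩
  length (filter f? (map (false ∷_) inputs)) + length (filter f? (map (true ∷_) inputs))
    ≡⟨ cong₂ _+_ (half false) (half true) ⟩
  count f ∎
  where
  open ≡-Reasoning
  inputs : List (Vec Bool n)
  inputs = allInputs n
  f? : ∀ z → Dec (f z ≡ true)
  f? z = f z ≟ true
  half : ∀ b → length (filter f? (map (b ∷_) inputs)) ≡ count (f ∘ (b ∷_))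
  half b = begin
    length (filter f? (map (b ∷_) inputs))        ≡⟨ cong length (filter-map f? (b ∷_) inputs) ⟩
    length (map (b ∷_) (preimage1 (f ∘ (b ∷_))))  ≡⟨ length-map (b ∷_) (preimage1 (f ∘ (b ∷_))) ⟩
    length (preimage1 (f ∘ (b ∷_)))               ≡⟨ length-preimage1 (f ∘ (b ∷_)) ⟩
    count (f ∘ (b ∷_))                            ∎

countPre≡count : (f : Vec Bool n → Bool) (i : Fin n) (b : Bool) → countPre f i b ≡ count (f ∩ bitIs i b)
countPre≡count {n} f i b =
  trans (cong length (filter-filter f (λ z → Vec.lookup z i ≟ b) (allInputs n)))
        (length-preimage1 (f ∩ bitIs i b))

lemma4p2 : ∀ {n} (rules : List (Rule n)) (vdef : Bool) →
    Unique (map ruleVar rules) →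
    Any (λ r → ruleVal r ≡ true) rules →
    (p : Fin (length rules)) →
    ruleVal (lookup rules p) ≡ true →
    (∀ (j : Fin (length rules)) → j < p → ruleVal (lookup rules j) ≡ false) →
    (length (preimage1 (evalDL rules vdef))
       ≤ 2 * countPre (evalDL rules vdef) (ruleVar (lookup rules p)) (ruleBit (lookup rules p)))
    × (∀ (j : Fin (length rules)) → p < j →
        (length (preimage1 (evalDL rules vdef))
           ≤ 4 * countPre (evalDL rules vdef) (ruleVar (lookup rules j)) true)
        × (4 * countPre (evalDL rules vdef) (ruleVar (lookup rules j)) true
           ≤ 3 * length (preimage1 (evalDL rules vdef))))
-- The Any hypothesis is implied by the existence of the pivot p.
lemma4p2 {n} rules vdef unique _ p vₚ≡true earlier-false
  rewrite length-preimage1 (evalDL rules vdef) =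
    subst (λ X → count f ≤ 2 * X) (sym (countPre≡count f _ _)) pivot-bound
  , λ j p<j →
      subst (λ X → count f ≤ 4 * X × 4 * X ≤ 3 * count f) (sym (countPre≡count f _ _))
        (later-bounds (var j) (distinct (<⇒≢ p<j))
          (reaches-flipInvariant rules p (λ i i<p → distinct (<⇒≢ (<-trans i<p p<j)))))
  where
  f : Vec Bool n → Bool
  f = evalDL rules vdef
  var : Fin (length rules) → Fin n
  var j = ruleVar (lookup rules j)
  distinct : ∀ {i j} → i ≢ j → var i ≢ var j
  distinct = unique-map⇒lookup-≢ ruleVar rules unique
  open PivotCounting
    (evalDL⊆reaches vdef rules p earlier-false)
    (evalDL≡reaches-on-fired vdef rules p vₚ≡true earlier-false)
    (reaches-flipInvariant rules p (λ i i<p → distinct (<⇒≢ i<p)))
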